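{- Let $p$ be a prime and let $m$ be an integer. Let $G$ be a vector space of dimension $d \geq 3$ over the field $\mathbb{F}_p$, and let $S \subseteq G$ be a subset such that $|S \cap H| \geq m p^{d-2}$ for every vector hyperplane $H$ of $G$ (i.e. every linear subspace of dimension $d-1$). Then $|S| \geq m p^{d-1}$. -}

module Defs where

open import Data.Nat using (ℕ; zero; suc; _+_; _*_)
open import Data.Nat.Divisibility using (_∣_; _∣?_)
open import Data.Fin using (Fin; toℕ)
open import Data.Vec using (Vec; []; _∷_)
open import Data.Vec.Relation.Unary.All using (All)
open import Data.List using (List; [_]; map; concatMap; length; filter; allFin)
open import Data.Bool using (Bool; true; false; T)
open import Data.Bool.Properties using (T?)
open import Relation.Binary.PropositionalEquality using (_≡_)
open import Relation.Nullary using (¬_)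

Vect : ℕ → ℕ → Set
Vect p d = Vec (Fin p) d

allVects : (p d : ℕ) → List (Vect p d)
allVects p zero    = [ [] ]
allVects p (suc d) = concatMap (λ x → map (x ∷_) (allVects p d)) (allFin p)

-- Standard bilinear pairing  a · x = Σ a_i x_i  (computed in ℕ; reduce mod p).
dot : ∀ {p d} → Vect p d → Vect p d → ℕ
dot []       []       = 0
dot (a ∷ as) (x ∷ xs) = toℕ a * toℕ x + dot as xs

IsZeroVect : ∀ {p d} → Vect p d → Set
IsZeroVect a = All (λ c → toℕ c ≡ 0) a

-- Membership in the hyperplane H_a = ker (x ↦ a · x) = { x | a · x ≡ 0 (mod p) }.
-- For a ≠ 0 these are exactly the vector hyperplanes (subspaces of dimension d-1).
InHyperplane : ∀ {p d} → Vect p d → Vect p d → Set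
InHyperplane {p} a x = p ∣ dot a x

card : ∀ {p d} → (Vect p d → Bool) → ℕ
card {p} {d} S = length (filter (λ x → T? (S x)) (allVects p d))

cardInHyperplane : ∀ {p d} → (Vect p d → Bool) → Vect p d → ℕ
cardInHyperplane {p} {d} S a =
  length (filter (λ x → T? (S x)) (filter (λ x → p ∣? dot a x) (allVects p d)))

{-# OPTIONS --safe #-}
-- Write H_a = {x | a·x ≡ 0} and K = m p^(d-2); for a = 0 this is the whole space, which still has
-- at least K points of S. For any a, b the hyperplanes H_b and H_(a+tb), t ∈ F_p, form a pencil: a
-- point of H_a ∩ H_b lies on all p + 1 of them, any other point on at most one. Summing the
-- hypothesis over the pencil gives (p + 1) K ≤ |S| + p |S ∩ H_a ∩ H_b|, so if |S| < pK then
-- |S ∩ H_a ∩ H_b| > K/p for every pair (a, b). As d ≥ 3, K/p is an integer, so each of these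
-- p^(2d) counts is at least K/p + 1. Their sum counts every x ∈ S once for each pair of hyperplanes
-- through x: at most p^(2d-2) times if x ≠ 0 and p^(2d) times if x = 0. Hence
-- p^(2d) (K/p + 1) ≤ p^(2d-2) |S| + p^(2d), i.e. |S| ≥ pK, a contradiction. For m < 0 the
-- bound is trivial.
module Submission where

open import Defs

module HyperplaneCounting where

  open import Data.Nat
  open import Data.Nat.Properties
  open import Data.Nat.DivMod using (_%_; _mod_; %-distribˡ-+; %-distribˡ-*; m%n%n≡m%n; m<n⇒m%n≡m)
  open import Data.Nat.Divisibility
    using (_∣_; _∣?_; _∣0; ∣m+n∣m⇒∣n; ∣n⇒∣m*n; n∣m⇒m%n≡0; m%n≡0⇒n∣m)
  open import Data.Nat.Primality using (Prime; prime⇒nonZero; prime⇒nonTrivial; euclidsLemma)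
  open import Data.Nat.Tactic.RingSolver using (solve-∀)
  open import Algebra.Properties.CommutativeSemigroup +-commutativeSemigroup
    using () renaming (interchange to +-interchange; x∙yz≈xz∙y to x+[y+z]≡x+z+y)
  open import Algebra.Properties.CommutativeSemigroup *-commutativeSemigroup
    using () renaming (x∙yz≈y∙xz to x*[y*z]≡y*[x*z])
  open import Data.Fin using (Fin; toℕ; fromℕ<)
  open import Data.Fin.Properties using (toℕ-injective; toℕ-fromℕ<; toℕ<n)
  open import Data.Vec using ([]; _∷_; zipWith; replicate)
  open import Data.Vec.Properties using (∷-injective)
  open import Data.Vec.Relation.Unary.All as VecAll using ([]; _∷_)
  open import Data.List
    using (List; []; _∷_; _++_; map; concatMap; length; filter; allFin; cartesianProductWith)
  open import Data.List.Properties using (length-tabulate; filter-all)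
  open import Data.List.Relation.Unary.All as All using (All; []; _∷_)
  open import Data.List.Relation.Unary.AllPairs using ([]; _∷_)
  open import Data.List.Relation.Unary.Unique.Propositional using (Unique)
  open import Data.List.Relation.Unary.Unique.Propositional.Properties
    using (allFin⁺; cartesianProductWith⁺)
  open import Data.Bool using (Bool)
  open import Data.Bool.Properties using (T?)
  open import Data.Sum using ([_,_]′)
  open import Function using (_∘_)
  open import Relation.Binary.PropositionalEquality
  open import Relation.Nullary using (¬_; Dec; yes; no; contradiction)
  open import Relation.Unary using (Pred; Decidable)

  𝟙 : ∀ {ℓ} {P : Set ℓ} → Dec P → ℕ
  𝟙 (yes _) = 1
  𝟙 (no _)  = 0

  𝟙≤1 : ∀ {ℓ} {P : Set ℓ} (P? : Dec P) → 𝟙 P? ≤ 1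
  𝟙≤1 (yes _) = ≤-refl
  𝟙≤1 (no _)  = z≤n

  𝟙-cong : ∀ {ℓ ℓ′} {P : Set ℓ} {Q : Set ℓ′} (P? : Dec P) (Q? : Dec Q) →
           (P → Q) → (Q → P) → 𝟙 P? ≡ 𝟙 Q?
  𝟙-cong (yes _) (yes _) _   _   = refl
  𝟙-cong (yes p) (no ¬q) p→q _   = contradiction (p→q p) ¬q
  𝟙-cong (no ¬p) (yes q) _   q→p = contradiction (q→p q) ¬p
  𝟙-cong (no _)  (no _)  _   _   = refl

  ∑ : ∀ {a} {A : Set a} → List A → (A → ℕ) → ℕ
  ∑ []       f = 0
  ∑ (x ∷ xs) f = f x + ∑ xs f

  -- ∑[ x ∈ xs ] f x * g x sums the products, but ∑[ x ∈ xs ] f x + c adds c to the sum.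
  infix 6.5 ∑
  syntax ∑ xs (λ x → e) = ∑[ x ∈ xs ] e

  module _ {a} {A : Set a} where

    ∑-cong : ∀ xs {f g : A → ℕ} → (∀ x → f x ≡ g x) → ∑ xs f ≡ ∑ xs g
    ∑-cong []       f≗g = refl
    ∑-cong (x ∷ xs) f≗g = cong₂ _+_ (f≗g x) (∑-cong xs f≗g)

    ∑-mono-≤ : ∀ xs {f g : A → ℕ} → (∀ x → f x ≤ g x) → ∑ xs f ≤ ∑ xs g
    ∑-mono-≤ []       f≤g = z≤n
    ∑-mono-≤ (x ∷ xs) f≤g = +-mono-≤ (f≤g x) (∑-mono-≤ xs f≤g)

    ∑-distrib-+ : ∀ xs (f g : A → ℕ) → ∑[ x ∈ xs ] (f x + g x) ≡ ∑ xs f + ∑ xs g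
    ∑-distrib-+ []       f g = refl
    ∑-distrib-+ (x ∷ xs) f g = begin
      f x + g x + ∑[ x ∈ xs ] (f x + g x) ≡⟨ cong (f x + g x +_) (∑-distrib-+ xs f g) ⟩
      f x + g x + (∑ xs f + ∑ xs g)       ≡⟨ +-interchange (f x) (g x) (∑ xs f) (∑ xs g) ⟩
      f x + ∑ xs f + (g x + ∑ xs g)       ∎
      where open ≡-Reasoning

    *-distribˡ-∑ : ∀ c xs (f : A → ℕ) → c * ∑ xs f ≡ ∑[ x ∈ xs ] c * f x
    *-distribˡ-∑ c []       f = *-zeroʳ c
    *-distribˡ-∑ c (x ∷ xs) f =
      trans (*-distribˡ-+ c (f x) (∑ xs f)) (cong (c * f x +_) (*-distribˡ-∑ c xs f))

    *-distribʳ-∑ : ∀ c xs (f : A → ℕ) → ∑ xs f * c ≡ ∑[ x ∈ xs ] f x * c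
    *-distribʳ-∑ c []       f = refl
    *-distribʳ-∑ c (x ∷ xs) f =
      trans (*-distribʳ-+ c (f x) (∑ xs f)) (cong (f x * c +_) (*-distribʳ-∑ c xs f))

    ∑-const : ∀ (xs : List A) c → ∑[ x ∈ xs ] c ≡ length xs * c
    ∑-const []       c = refl
    ∑-const (x ∷ xs) c = cong (c +_) (∑-const xs c)

    length≡∑1 : ∀ (xs : List A) → length xs ≡ ∑[ x ∈ xs ] 1
    length≡∑1 []       = refl
    length≡∑1 (x ∷ xs) = cong suc (length≡∑1 xs)

    ∑-++ : ∀ xs ys (f : A → ℕ) → ∑ (xs ++ ys) f ≡ ∑ xs f + ∑ ys f
    ∑-++ []       ys f = refl
    ∑-++ (x ∷ xs) ys f = trans (cong (f x +_) (∑-++ xs ys f)) (sym (+-assoc (f x) (∑ xs f) (∑ ys f)))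

    ∑-filter : ∀ {ℓ} {P : Pred A ℓ} (P? : Decidable P) xs (f : A → ℕ) →
               ∑ (filter P? xs) f ≡ ∑[ x ∈ xs ] 𝟙 (P? x) * f x
    ∑-filter P? []       f = refl
    ∑-filter P? (x ∷ xs) f with P? x
    ... | yes _ = cong₂ _+_ (sym (+-identityʳ (f x))) (∑-filter P? xs f)
    ... | no _  = ∑-filter P? xs f

    length-filter≡∑𝟙 : ∀ {ℓ} {P : Pred A ℓ} (P? : Decidable P) xs →
                       length (filter P? xs) ≡ ∑[ x ∈ xs ] 𝟙 (P? x)
    length-filter≡∑𝟙 P? []       = refl
    length-filter≡∑𝟙 P? (x ∷ xs) with P? x
    ... | yes _ = cong suc (length-filter≡∑𝟙 P? xs)
    ... | no _  = length-filter≡∑𝟙 P? xs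

    ∑𝟙≤length : ∀ {ℓ} {P : Pred A ℓ} (P? : Decidable P) xs → ∑[ x ∈ xs ] 𝟙 (P? x) ≤ length xs
    ∑𝟙≤length P? []       = z≤n
    ∑𝟙≤length P? (x ∷ xs) = +-mono-≤ (𝟙≤1 (P? x)) (∑𝟙≤length P? xs)

    ∑𝟙≡0 : ∀ {ℓ} {P : Pred A ℓ} (P? : Decidable P) {xs} →
           All (¬_ ∘ P) xs → ∑[ x ∈ xs ] 𝟙 (P? x) ≡ 0
    ∑𝟙≡0 P? []              = refl
    ∑𝟙≡0 P? {x ∷ _} (¬px ∷ ¬P) with P? x
    ... | yes px = contradiction px ¬px
    ... | no _   = ∑𝟙≡0 P? ¬P

    ∑𝟙≤1 : ∀ {ℓ} {P : Pred A ℓ} (P? : Decidable P) → (∀ {x y} → P x → P y → x ≡ y) →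
           ∀ {xs} → Unique xs → ∑[ x ∈ xs ] 𝟙 (P? x) ≤ 1
    ∑𝟙≤1 P? P-unique {[]}    []              = z≤n
    ∑𝟙≤1 P? P-unique {x ∷ _} (x∉xs ∷ xs-unique) with P? x
    ... | yes px = ≤-reflexive (cong suc (∑𝟙≡0 P? (All.map (λ x≢y py → x≢y (P-unique px py)) x∉xs)))
    ... | no _   = ∑𝟙≤1 P? P-unique xs-unique

  ∑-comm : ∀ {a b} {A : Set a} {B : Set b} xs (ys : List B) (f : A → B → ℕ) →
           ∑[ x ∈ xs ] ∑[ y ∈ ys ] f x y ≡ ∑[ y ∈ ys ] ∑[ x ∈ xs ] f x y
  ∑-comm []       ys f = sym (trans (∑-const ys 0) (*-zeroʳ (length ys)))
  ∑-comm (x ∷ xs) ys f = trans (cong (∑ ys (f x) +_) (∑-comm xs ys f))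
                               (sym (∑-distrib-+ ys (f x) (λ y → ∑[ x ∈ xs ] f x y)))

  ∑*∑≡∑∑ : ∀ {a b} {A : Set a} {B : Set b} xs (ys : List B) (f : A → ℕ) (g : B → ℕ) →
           ∑ xs f * ∑ ys g ≡ ∑[ x ∈ xs ] ∑[ y ∈ ys ] f x * g y
  ∑*∑≡∑∑ xs ys f g = trans (*-distribʳ-∑ (∑ ys g) xs f)
                           (∑-cong xs (λ x → *-distribˡ-∑ (f x) ys g))

  ∑-concatMap-map : ∀ {a b c} {A : Set a} {B : Set b} {C : Set c} (g : A → B → C) xs ys (f : C → ℕ) →
                    ∑ (concatMap (λ x → map (g x) ys) xs) f ≡ ∑[ x ∈ xs ] ∑[ y ∈ ys ] f (g x y)
  ∑-concatMap-map g []       ys f = refl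
  ∑-concatMap-map g (x ∷ xs) ys f = begin
    ∑ (map (g x) ys ++ concatMap (λ x → map (g x) ys) xs) f
      ≡⟨ ∑-++ (map (g x) ys) _ f ⟩
    ∑ (map (g x) ys) f + ∑ (concatMap (λ x → map (g x) ys) xs) f
      ≡⟨ cong₂ _+_ (∑-map ys) (∑-concatMap-map g xs ys f) ⟩
    ∑[ y ∈ ys ] f (g x y) + ∑[ x ∈ xs ] ∑[ y ∈ ys ] f (g x y)
      ∎
    where
    open ≡-Reasoning
    ∑-map : ∀ ys → ∑ (map (g x) ys) f ≡ ∑[ y ∈ ys ] f (g x y)
    ∑-map []       = refl
    ∑-map (y ∷ ys) = cong (f (g x y) +_) (∑-map ys)

  concatMap-map≡cartesianProductWith : ∀ {a b c} {A : Set a} {B : Set b} {C : Set c} (g : A → B → C) xs ys →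
                                       concatMap (λ x → map (g x) ys) xs ≡ cartesianProductWith g xs ys
  concatMap-map≡cartesianProductWith g []       ys = refl
  concatMap-map≡cartesianProductWith g (x ∷ xs) ys =
    cong (map (g x) ys ++_) (concatMap-map≡cartesianProductWith g xs ys)

  module _ {p : ℕ} where

    ∑-allVects-suc : ∀ d (f : Vect p (suc d) → ℕ) →
                     ∑ (allVects p (suc d)) f ≡ ∑[ x₀ ∈ allFin p ] ∑[ xs ∈ allVects p d ] f (x₀ ∷ xs)
    ∑-allVects-suc d f = ∑-concatMap-map _∷_ (allFin p) (allVects p d) f

    length-allFin : length (allFin p) ≡ p
    length-allFin = length-tabulate (λ i → i)

    ∑-allFin-const : ∀ c → ∑[ t ∈ allFin p ] c ≡ p * c
    ∑-allFin-const c = trans (∑-const (allFin p) c) (cong (_* c) length-allFin)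

    length-allVects : ∀ d → length (allVects p d) ≡ p ^ d
    length-allVects zero    = refl
    length-allVects (suc d) = begin
      length (allVects p (suc d))
        ≡⟨ length≡∑1 (allVects p (suc d)) ⟩
      ∑[ x ∈ allVects p (suc d) ] 1
        ≡⟨ ∑-allVects-suc d (λ _ → 1) ⟩
      ∑[ x₀ ∈ allFin p ] ∑[ xs ∈ allVects p d ] 1
        ≡⟨ ∑-cong (allFin p) (λ _ → length≡∑1 (allVects p d)) ⟨
      ∑[ x₀ ∈ allFin p ] length (allVects p d)
        ≡⟨ ∑-allFin-const (length (allVects p d)) ⟩
      p * length (allVects p d)
        ≡⟨ cong (p *_) (length-allVects d) ⟩
      p * p ^ d
        ∎
      where open ≡-Reasoning

    ∑-allVects-const : ∀ d c → ∑[ x ∈ allVects p d ] c ≡ p ^ d * c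
    ∑-allVects-const d c = trans (∑-const (allVects p d) c) (cong (_* c) (length-allVects d))

    allVects-unique : ∀ d → Unique (allVects p d)
    allVects-unique zero    = [] ∷ []
    allVects-unique (suc d) =
      subst Unique (sym (concatMap-map≡cartesianProductWith _∷_ (allFin p) (allVects p d)))
        (cartesianProductWith⁺ _∷_ ∷-injective (allFin⁺ p) (allVects-unique d))

    isZero? : ∀ {d} (x : Vect p d) → Dec (IsZeroVect x)
    isZero? = VecAll.all? (λ c → toℕ c ≟ 0)

    zeroVect-unique : ∀ {d} {x y : Vect p d} → IsZeroVect x → IsZeroVect y → x ≡ y
    zeroVect-unique []            []            = refl
    zeroVect-unique (x₀≡0 ∷ xs≡0) (y₀≡0 ∷ ys≡0) =
      cong₂ _∷_ (toℕ-injective (trans x₀≡0 (sym y₀≡0))) (zeroVect-unique xs≡0 ys≡0)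

    #zeroVects≤1 : ∀ d → ∑[ x ∈ allVects p d ] 𝟙 (isZero? x) ≤ 1
    #zeroVects≤1 d = ∑𝟙≤1 isZero? zeroVect-unique (allVects-unique d)

    dot-zeroˡ : ∀ {d} {a x : Vect p d} → IsZeroVect a → dot a x ≡ 0
    dot-zeroˡ {a = []}    {[]}    []            = refl
    dot-zeroˡ {a = _ ∷ _} {_ ∷ _} (a₀≡0 ∷ as≡0) rewrite a₀≡0 = dot-zeroˡ as≡0

    χH : ∀ {d} → Vect p d → Vect p d → ℕ
    χH a x = 𝟙 (p ∣? dot a x)

    module _ {d} (S : Vect p d → Bool) where

      χS : Vect p d → ℕ
      χS x = 𝟙 (T? (S x))

      card≡∑ : card S ≡ ∑[ x ∈ allVects p d ] χS x
      card≡∑ = length-filter≡∑𝟙 (T? ∘ S) (allVects p d)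

      cardInHyperplane≡∑ : ∀ a → cardInHyperplane S a ≡ ∑[ x ∈ allVects p d ] χH a x * χS x
      cardInHyperplane≡∑ a =
        trans (length-filter≡∑𝟙 (T? ∘ S) (filter (λ x → p ∣? dot a x) (allVects p d)))
              (∑-filter (λ x → p ∣? dot a x) (allVects p d) χS)

      cardInHyperplane≤card : ∀ a → cardInHyperplane S a ≤ card S
      cardInHyperplane≤card a = begin
        cardInHyperplane S a
          ≡⟨ cardInHyperplane≡∑ a ⟩
        ∑[ x ∈ allVects p d ] χH a x * χS x
          ≤⟨ ∑-mono-≤ (allVects p d) (λ x → *-monoˡ-≤ (χS x) (𝟙≤1 (p ∣? dot a x))) ⟩
        ∑[ x ∈ allVects p d ] 1 * χS x
          ≡⟨ ∑-cong (allVects p d) (λ x → *-identityˡ (χS x)) ⟩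
        ∑[ x ∈ allVects p d ] χS x
          ≡⟨ card≡∑ ⟨
        card S
          ∎
        where open ≤-Reasoning

      cardInHyperplane-zero : ∀ {a} → IsZeroVect a → cardInHyperplane S a ≡ card S
      cardInHyperplane-zero {a} a≡0 = cong (length ∘ filter (T? ∘ S))
        (filter-all (λ x → p ∣? dot a x) (All.universal p∣a·x (allVects p d)))
        where
        p∣a·x : ∀ x → p ∣ dot a x
        p∣a·x x = subst (p ∣_) (sym (dot-zeroˡ a≡0)) (p ∣0)

      cardInHyperplanes : Vect p d → Vect p d → ℕ
      cardInHyperplanes a b = ∑[ x ∈ allVects p d ] χH a x * (χH b x * χS x)

  m∣n∧n<m⇒n≡0 : ∀ {m n} .{{_ : NonZero m}} → m ∣ n → n < m → n ≡ 0
  m∣n∧n<m⇒n≡0 {m} {n} m∣n n<m = trans (sym (m<n⇒m%n≡m n<m)) (n∣m⇒m%n≡0 n m m∣n)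

  module _ {p : ℕ} .{{_ : NonZero p}} where

    %-cong-+ : ∀ {m m′ n n′} → m % p ≡ m′ % p → n % p ≡ n′ % p → (m + n) % p ≡ (m′ + n′) % p
    %-cong-+ {m} {m′} {n} {n′} m≡m′ n≡n′ = begin
      (m + n) % p             ≡⟨ %-distribˡ-+ m n p ⟩
      (m % p + n % p) % p     ≡⟨ cong₂ (λ u v → (u + v) % p) m≡m′ n≡n′ ⟩
      (m′ % p + n′ % p) % p   ≡⟨ %-distribˡ-+ m′ n′ p ⟨
      (m′ + n′) % p           ∎
      where open ≡-Reasoning

    %-cong-*ʳ : ∀ {m m′} n → m % p ≡ m′ % p → (m * n) % p ≡ (m′ * n) % p
    %-cong-*ʳ {m} {m′} n m≡m′ = begin
      (m * n) % p             ≡⟨ %-distribˡ-* m n p ⟩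
      (m % p * (n % p)) % p   ≡⟨ cong (λ u → (u * (n % p)) % p) m≡m′ ⟩
      (m′ % p * (n % p)) % p  ≡⟨ %-distribˡ-* m′ n p ⟨
      (m′ * n) % p            ∎
      where open ≡-Reasoning

    %-cong-∣ : ∀ {m n} → m % p ≡ n % p → p ∣ m → p ∣ n
    %-cong-∣ {m} {n} m≡n p∣m = m%n≡0⇒n∣m n p (trans (sym m≡n) (n∣m⇒m%n≡0 m p p∣m))

    toℕ≢0⇒∤ : (c : Fin p) → toℕ c ≢ 0 → ¬ p ∣ toℕ c
    toℕ≢0⇒∤ c c≢0 p∣c = c≢0 (m∣n∧n<m⇒n≡0 p∣c (toℕ<n c))

    addScaled : ∀ {d} → Vect p d → Fin p → Vect p d → Vect p d
    addScaled a t b = zipWith (λ aᵢ bᵢ → (toℕ aᵢ + toℕ t * toℕ bᵢ) mod p) a b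

    dot-addScaled : ∀ {d} (a : Vect p d) t b x → dot (addScaled a t b) x % p ≡ (dot a x + toℕ t * dot b x) % p
    dot-addScaled []        t []        []        = cong (_% p) (sym (*-zeroʳ (toℕ t)))
    dot-addScaled (a₀ ∷ as) t (b₀ ∷ bs) (x₀ ∷ xs) = begin
      (toℕ ((A₀ + T * B₀) mod p) * X₀ + dot (addScaled as t bs) xs) % p
        ≡⟨ %-cong-+ (%-cong-*ʳ X₀ toℕ-mod) (dot-addScaled as t bs xs) ⟩
      ((A₀ + T * B₀) * X₀ + (dot as xs + T * dot bs xs)) % p
        ≡⟨ cong (_% p) (regroup A₀ T B₀ X₀ (dot as xs) (dot bs xs)) ⟩
      (A₀ * X₀ + dot as xs + T * (B₀ * X₀ + dot bs xs)) % p
        ∎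
      where
      open ≡-Reasoning
      A₀ B₀ X₀ T : ℕ
      A₀ = toℕ a₀
      B₀ = toℕ b₀
      X₀ = toℕ x₀
      T  = toℕ t
      toℕ-mod : toℕ ((A₀ + T * B₀) mod p) % p ≡ (A₀ + T * B₀) % p
      toℕ-mod = trans (cong (_% p) (toℕ-fromℕ< _)) (m%n%n≡m%n (A₀ + T * B₀) p)
      regroup : ∀ a t b x u v → (a + t * b) * x + (u + t * v) ≡ a * x + u + t * (b * x + v)
      regroup = solve-∀

    χH-addScaled : ∀ {d} (a : Vect p d) t b x → χH (addScaled a t b) x ≡ 𝟙 (p ∣? dot a x + toℕ t * dot b x)
    χH-addScaled a t b x =
      𝟙-cong (p ∣? _) (p ∣? _) (%-cong-∣ (dot-addScaled a t b x)) (%-cong-∣ (sym (dot-addScaled a t b x)))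

  module _ {p : ℕ} (prime : Prime p) where

    private instance
      p≢0 : NonZero p
      p≢0 = prime⇒nonZero prime

    linearRoot-unique : ∀ {y} → ¬ p ∣ y → ∀ r {i j : Fin p} →
                        p ∣ r + toℕ i * y → p ∣ r + toℕ j * y → i ≡ j
    linearRoot-unique {y} p∤y r {i} {j} p∣i p∣j =
      [ ordered p∣i p∣j , (λ j≤i → sym (ordered p∣j p∣i j≤i)) ]′ (≤-total (toℕ i) (toℕ j))
      where
      ordered : ∀ {i j : Fin p} → p ∣ r + toℕ i * y → p ∣ r + toℕ j * y → toℕ i ≤ toℕ j → i ≡ j
      ordered {i} {j} p∣i p∣j i≤j = toℕ-injective (≤-antisym i≤j (m∸n≡0⇒m≤n j∸i≡0))
        where
        open ≡-Reasoning
        split : r + toℕ j * y ≡ r + toℕ i * y + (toℕ j ∸ toℕ i) * y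
        split = begin
          r + toℕ j * y                          ≡⟨ cong (λ k → r + k * y) (m+[n∸m]≡n i≤j) ⟨
          r + (toℕ i + (toℕ j ∸ toℕ i)) * y      ≡⟨ cong (r +_) (*-distribʳ-+ y (toℕ i) _) ⟩
          r + (toℕ i * y + (toℕ j ∸ toℕ i) * y)  ≡⟨ +-assoc r _ _ ⟨
          r + toℕ i * y + (toℕ j ∸ toℕ i) * y    ∎
        j∸i<p : toℕ j ∸ toℕ i < p
        j∸i<p = ≤-<-trans (m∸n≤m (toℕ j) (toℕ i)) (toℕ<n j)
        j∸i≡0 : toℕ j ∸ toℕ i ≡ 0
        j∸i≡0 = [ (λ p∣j∸i → m∣n∧n<m⇒n≡0 p∣j∸i j∸i<p) , (λ p∣y → contradiction p∣y p∤y) ]′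
                  (euclidsLemma _ _ prime (∣m+n∣m⇒∣n (subst (p ∣_) split p∣j) p∣i))

    #linearRoots≤1 : ∀ {y} → ¬ p ∣ y → ∀ r → ∑[ t ∈ allFin p ] 𝟙 (p ∣? r + toℕ t * y) ≤ 1
    #linearRoots≤1 p∤y r = ∑𝟙≤1 (λ t → p ∣? r + toℕ t * _) (linearRoot-unique p∤y r) (allFin⁺ p)

    -- The offset r lets the count be computed by induction on the first coordinate.
    #solutions : ∀ {d} → Vect p d → ℕ → ℕ
    #solutions {d} x r = ∑[ a ∈ allVects p d ] 𝟙 (p ∣? r + dot a x)

    #solutions≤p^d : ∀ {d} (x : Vect p d) r → #solutions x r ≤ p ^ d
    #solutions≤p^d {d} x r =
      ≤-trans (∑𝟙≤length (λ a → p ∣? r + dot a x) (allVects p d)) (≤-reflexive (length-allVects d))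

    #solutions-nonzero≤ : ∀ {d} (x : Vect p (suc d)) r → ¬ IsZeroVect x → #solutions x r ≤ p ^ d
    #solutions-nonzero≤ {d} (x₀ ∷ xs) r x≢0 with toℕ x₀ ≟ 0
    #solutions-nonzero≤ {d} (x₀ ∷ xs) r x≢0 | no x₀≢0 = begin
      #solutions (x₀ ∷ xs) r
        ≡⟨ ∑-allVects-suc {p} d _ ⟩
      ∑[ a₀ ∈ allFin p ] ∑[ as ∈ allVects p d ] 𝟙 (p ∣? r + (toℕ a₀ * toℕ x₀ + dot as xs))
        ≡⟨ ∑-comm (allFin p) (allVects p d) _ ⟩
      ∑[ as ∈ allVects p d ] ∑[ a₀ ∈ allFin p ] 𝟙 (p ∣? r + (toℕ a₀ * toℕ x₀ + dot as xs))
        ≡⟨ ∑-cong (allVects p d) (λ as → ∑-cong (allFin p) (λ a₀ →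
             cong (𝟙 ∘ (p ∣?_)) (x+[y+z]≡x+z+y r _ _))) ⟩
      ∑[ as ∈ allVects p d ] ∑[ a₀ ∈ allFin p ] 𝟙 (p ∣? r + dot as xs + toℕ a₀ * toℕ x₀)
        ≤⟨ ∑-mono-≤ (allVects p d) (λ as → #linearRoots≤1 (toℕ≢0⇒∤ x₀ x₀≢0) (r + dot as xs)) ⟩
      ∑[ as ∈ allVects p d ] 1
        ≡⟨ trans (∑-allVects-const {p} d 1) (*-identityʳ (p ^ d)) ⟩
      p ^ d ∎
      where open ≤-Reasoning
    #solutions-nonzero≤ {zero}  (x₀ ∷ []) r x≢0 | yes x₀≡0 = contradiction (x₀≡0 ∷ []) x≢0
    #solutions-nonzero≤ {suc d} (x₀ ∷ xs) r x≢0 | yes x₀≡0 = begin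
      #solutions (x₀ ∷ xs) r
        ≡⟨ ∑-allVects-suc {p} (suc d) _ ⟩
      ∑[ a₀ ∈ allFin p ] ∑[ as ∈ allVects p (suc d) ] 𝟙 (p ∣? r + (toℕ a₀ * toℕ x₀ + dot as xs))
        ≡⟨ ∑-cong (allFin p) (λ a₀ → ∑-cong (allVects p (suc d)) (λ as →
             cong (𝟙 ∘ (p ∣?_)) (+-assoc r _ _))) ⟨
      ∑[ a₀ ∈ allFin p ] #solutions xs (r + toℕ a₀ * toℕ x₀)
        ≤⟨ ∑-mono-≤ (allFin p) (λ a₀ → #solutions-nonzero≤ xs _ (x≢0 ∘ (x₀≡0 ∷_))) ⟩
      ∑[ a₀ ∈ allFin p ] p ^ d
        ≡⟨ ∑-allFin-const {p} (p ^ d) ⟩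
      p * p ^ d ∎
      where open ≤-Reasoning

    #pencilRoots≤ : ∀ A B → ∑[ t ∈ allFin p ] 𝟙 (p ∣? A + toℕ t * B) + 𝟙 (p ∣? B)
                            ≤ 1 + p * (𝟙 (p ∣? A) * 𝟙 (p ∣? B))
    #pencilRoots≤ A B with p ∣? B
    ... | no p∤B = begin
      ∑[ t ∈ allFin p ] 𝟙 (p ∣? A + toℕ t * B) + 0  ≡⟨ +-identityʳ _ ⟩
      ∑[ t ∈ allFin p ] 𝟙 (p ∣? A + toℕ t * B)      ≤⟨ #linearRoots≤1 p∤B A ⟩
      1                                             ≤⟨ m≤m+n 1 _ ⟩
      1 + p * (𝟙 (p ∣? A) * 0)                      ∎
      where open ≤-Reasoning
    ... | yes p∣B with p ∣? A
    ...   | yes _ = begin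
      ∑[ t ∈ allFin p ] 𝟙 (p ∣? A + toℕ t * B) + 1  ≤⟨ +-monoˡ-≤ 1 (∑𝟙≤length _ (allFin p)) ⟩
      length (allFin p) + 1                         ≡⟨ cong (_+ 1) (length-allFin {p}) ⟩
      p + 1                                         ≡⟨ +-comm p 1 ⟩
      1 + p                                         ≡⟨ cong (1 +_) (*-identityʳ p) ⟨
      1 + p * 1                                     ∎
      where open ≤-Reasoning
    ...   | no p∤A = begin
      ∑[ t ∈ allFin p ] 𝟙 (p ∣? A + toℕ t * B) + 1  ≡⟨ cong (_+ 1) (∑𝟙≡0 _ ¬p∣A+tB) ⟩
      1                                             ≤⟨ m≤m+n 1 _ ⟩
      1 + p * 0                                     ∎
      where
      open ≤-Reasoning
      ¬p∣A+tB : All (λ t → ¬ p ∣ A + toℕ t * B) (allFin p)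
      ¬p∣A+tB = All.universal (λ t p∣A+tB → p∤A (∣m+n∣m⇒∣n (subst (p ∣_) (+-comm A _) p∣A+tB) (p∣tB t)))
                              (allFin p)
        where
        p∣tB : ∀ t → p ∣ toℕ t * B
        p∣tB t = ∣n⇒∣m*n (toℕ t) p∣B

    #pencilHyperplanesThrough≤ : ∀ {d} (a b x : Vect p d) →
                                 ∑[ t ∈ allFin p ] χH (addScaled a t b) x + χH b x
                                 ≤ 1 + p * (χH a x * χH b x)
    #pencilHyperplanesThrough≤ a b x = begin
      ∑[ t ∈ allFin p ] χH (addScaled a t b) x + χH b x
        ≡⟨ cong (_+ χH b x) (∑-cong (allFin p) (λ t → χH-addScaled a t b x)) ⟩
      ∑[ t ∈ allFin p ] 𝟙 (p ∣? dot a x + toℕ t * dot b x) + χH b x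
        ≤⟨ #pencilRoots≤ (dot a x) (dot b x) ⟩
      1 + p * (χH a x * χH b x) ∎
      where open ≤-Reasoning

    module _ {d} (S : Vect p d → Bool) where

      pencil : ∀ a b → ∑[ t ∈ allFin p ] cardInHyperplane S (addScaled a t b) + cardInHyperplane S b
                       ≤ card S + p * cardInHyperplanes S a b
      pencil a b = begin
        ∑[ t ∈ allFin p ] cardInHyperplane S (addScaled a t b) + cardInHyperplane S b
          ≡⟨ cong₂ _+_ (∑-cong (allFin p) (λ t → cardInHyperplane≡∑ S (addScaled a t b)))
                       (cardInHyperplane≡∑ S b) ⟩
        ∑[ t ∈ allFin p ] ∑[ x ∈ V ] χH (addScaled a t b) x * χS S x + ∑[ x ∈ V ] χH b x * χS S x
          ≡⟨ cong (_+ ∑[ x ∈ V ] χH b x * χS S x) (∑-comm (allFin p) V _) ⟩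
        ∑[ x ∈ V ] ∑[ t ∈ allFin p ] χH (addScaled a t b) x * χS S x + ∑[ x ∈ V ] χH b x * χS S x
          ≡⟨ ∑-distrib-+ V _ _ ⟨
        ∑[ x ∈ V ] (∑[ t ∈ allFin p ] χH (addScaled a t b) x * χS S x + χH b x * χS S x)
          ≡⟨ ∑-cong V (λ x → factor-χS x) ⟩
        ∑[ x ∈ V ] (∑[ t ∈ allFin p ] χH (addScaled a t b) x + χH b x) * χS S x
          ≤⟨ ∑-mono-≤ V (λ x → *-monoˡ-≤ (χS S x) (#pencilHyperplanesThrough≤ a b x)) ⟩
        ∑[ x ∈ V ] (1 + p * (χH a x * χH b x)) * χS S x
          ≡⟨ ∑-cong V (λ x → expand p (χH a x) (χH b x) (χS S x)) ⟩
        ∑[ x ∈ V ] (χS S x + p * (χH a x * (χH b x * χS S x)))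
          ≡⟨ ∑-distrib-+ V _ _ ⟩
        ∑[ x ∈ V ] χS S x + ∑[ x ∈ V ] p * (χH a x * (χH b x * χS S x))
          ≡⟨ cong₂ _+_ (card≡∑ S) (*-distribˡ-∑ p V _) ⟨
        card S + p * cardInHyperplanes S a b ∎
        where
        open ≤-Reasoning
        V : List (Vect p d)
        V = allVects p d
        factor-χS : ∀ x → ∑[ t ∈ allFin p ] χH (addScaled a t b) x * χS S x + χH b x * χS S x
                          ≡ (∑[ t ∈ allFin p ] χH (addScaled a t b) x + χH b x) * χS S x
        factor-χS x = sym (trans (*-distribʳ-+ (χS S x) (∑[ t ∈ allFin p ] χH (addScaled a t b) x) (χH b x))
                                 (cong (_+ χH b x * χS S x) (*-distribʳ-∑ (χS S x) (allFin p) _)))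
        expand : ∀ q u v s → (1 + q * (u * v)) * s ≡ s + q * (u * (v * s))
        expand = solve-∀

      cardInHyperplanes> : ∀ {N} → (∀ a → p * N ≤ cardInHyperplane S a) → card S < p * (p * N) →
                           ∀ a b → N < cardInHyperplanes S a b
      cardInHyperplanes> {N} pN≤ s<p²N a b =
        *-cancelˡ-< p N ℓ (+-cancelˡ-< (p * (p * N)) (p * N) (p * ℓ) (begin-strict
        p * (p * N) + p * N
          ≡⟨ cong (_+ p * N) (∑-allFin-const {p} (p * N)) ⟨
        ∑[ t ∈ allFin p ] p * N + p * N
          ≤⟨ +-mono-≤ (∑-mono-≤ (allFin p) (λ t → pN≤ (addScaled a t b))) (pN≤ b) ⟩
        ∑[ t ∈ allFin p ] cardInHyperplane S (addScaled a t b) + cardInHyperplane S b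
          ≤⟨ pencil a b ⟩
        card S + p * ℓ
          <⟨ +-monoˡ-< (p * ℓ) s<p²N ⟩
        p * (p * N) + p * ℓ ∎))
        where
        open ≤-Reasoning
        ℓ : ℕ
        ℓ = cardInHyperplanes S a b

      ∑∑cardInHyperplanes≡ : ∑[ a ∈ allVects p d ] ∑[ b ∈ allVects p d ] cardInHyperplanes S a b
                             ≡ ∑[ x ∈ allVects p d ] #solutions x 0 * (#solutions x 0 * χS S x)
      ∑∑cardInHyperplanes≡ = begin
        ∑[ a ∈ V ] ∑[ b ∈ V ] ∑[ x ∈ V ] χH a x * (χH b x * χS S x)
          ≡⟨ ∑-cong V (λ a → ∑-comm V V _) ⟩
        ∑[ a ∈ V ] ∑[ x ∈ V ] ∑[ b ∈ V ] χH a x * (χH b x * χS S x)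
          ≡⟨ ∑-comm V V _ ⟩
        ∑[ x ∈ V ] ∑[ a ∈ V ] ∑[ b ∈ V ] χH a x * (χH b x * χS S x)
          ≡⟨ ∑-cong V (λ x → ∑*∑≡∑∑ V V (λ a → χH a x) (λ b → χH b x * χS S x)) ⟨
        ∑[ x ∈ V ] (∑[ a ∈ V ] χH a x) * (∑[ b ∈ V ] χH b x * χS S x)
          ≡⟨ ∑-cong V (λ x → cong (#solutions x 0 *_) (*-distribʳ-∑ (χS S x) V (λ b → χH b x))) ⟨
        ∑[ x ∈ V ] #solutions x 0 * (#solutions x 0 * χS S x) ∎
        where
        open ≡-Reasoning
        V : List (Vect p d)
        V = allVects p d

    module _ {k} (S : Vect p (suc k) → Bool) where

      ∑∑cardInHyperplanes≤ : ∑[ a ∈ allVects p (suc k) ] ∑[ b ∈ allVects p (suc k) ] cardInHyperplanes S a b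
                             ≤ p ^ k * (p ^ k * card S) + p ^ suc k * p ^ suc k
      ∑∑cardInHyperplanes≤ = begin
        ∑[ a ∈ V ] ∑[ b ∈ V ] cardInHyperplanes S a b
          ≡⟨ ∑∑cardInHyperplanes≡ S ⟩
        ∑[ x ∈ V ] #solutions x 0 * (#solutions x 0 * χS S x)
          ≤⟨ ∑-mono-≤ V bound-at ⟩
        ∑[ x ∈ V ] (q * (q * χS S x) + Q * (Q * 𝟙 (isZero? x)))
          ≡⟨ ∑-distrib-+ V _ _ ⟩
        ∑[ x ∈ V ] q * (q * χS S x) + ∑[ x ∈ V ] Q * (Q * 𝟙 (isZero? x))
          ≡⟨ cong₂ _+_ (∑-scale₂ q (χS S)) (∑-scale₂ Q (λ x → 𝟙 (isZero? x))) ⟨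
        q * (q * ∑ V (χS S)) + Q * (Q * ∑ V (λ x → 𝟙 (isZero? x)))
          ≤⟨ +-mono-≤ (≤-reflexive (cong (λ s → q * (q * s)) (sym (card≡∑ S))))
                      (*-monoʳ-≤ Q (*-monoʳ-≤ Q (#zeroVects≤1 {p} (suc k)))) ⟩
        q * (q * card S) + Q * (Q * 1)
          ≡⟨ cong (λ n → q * (q * card S) + Q * n) (*-identityʳ Q) ⟩
        q * (q * card S) + Q * Q ∎
        where
        open ≤-Reasoning
        V : List (Vect p (suc k))
        V = allVects p (suc k)
        q Q : ℕ
        q = p ^ k
        Q = p ^ suc k
        ∑-scale₂ : ∀ c f → c * (c * ∑ V f) ≡ ∑[ x ∈ V ] c * (c * f x)
        ∑-scale₂ c f = trans (cong (c *_) (*-distribˡ-∑ c V f)) (*-distribˡ-∑ c V (λ x → c * f x))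
        bound-at : ∀ x → #solutions x 0 * (#solutions x 0 * χS S x)
                         ≤ q * (q * χS S x) + Q * (Q * 𝟙 (isZero? x))
        bound-at x with isZero? x
        ... | no x≢0 = ≤-trans (*-mono-≤ N≤q (*-monoˡ-≤ (χS S x) N≤q)) (m≤m+n _ _)
          where
          N≤q : #solutions x 0 ≤ q
          N≤q = #solutions-nonzero≤ x 0 x≢0
        ... | yes _  = ≤-trans (*-mono-≤ N≤Q (*-mono-≤ N≤Q (𝟙≤1 (T? (S x))))) (m≤n+m _ _)
          where
          N≤Q : #solutions x 0 ≤ Q
          N≤Q = #solutions≤p^d x 0

      hyperplaneBound-everywhere : ∀ {K} → (∀ a → ¬ IsZeroVect a → K ≤ cardInHyperplane S a) →
                                   ∀ a → K ≤ cardInHyperplane S a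
      hyperplaneBound-everywhere {K} K≤ a with isZero? a
      ... | no a≢0 = K≤ a a≢0
      ... | yes a≡0 = begin
        K                          ≤⟨ K≤ ones ones≢0 ⟩
        cardInHyperplane S ones    ≤⟨ cardInHyperplane≤card S ones ⟩
        card S                     ≡⟨ cardInHyperplane-zero S a≡0 ⟨
        cardInHyperplane S a       ∎
        where
        open ≤-Reasoning
        1<p : 1 < p
        1<p = nonTrivial⇒n>1 p {{prime⇒nonTrivial prime}}
        ones : Vect p (suc k)
        ones = replicate (suc k) (fromℕ< 1<p)
        ones≢0 : ¬ IsZeroVect ones
        ones≢0 (one≡0 ∷ _) = 1+n≢0 (trans (sym (toℕ-fromℕ< 1<p)) one≡0)

    cardBound : ∀ {k} (S : Vect p (suc k) → Bool) N →
                (∀ a → ¬ IsZeroVect a → p * N ≤ cardInHyperplane S a) → p * (p * N) ≤ card S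
    cardBound {k} S N hyp = ≮⇒≥ λ s<p²N → <⇒≱ s<p²N (*-cancelˡ-≤ q (*-cancelˡ-≤ q (begin
      q * (q * (p * (p * N)))  ≡⟨ rescale p q N ⟩
      Q * (Q * N)              ≤⟨ +-cancelʳ-≤ (Q * Q) _ _ (doubleCount s<p²N) ⟩
      q * (q * card S)         ∎)))
      where
      open ≤-Reasoning
      V : List (Vect p (suc k))
      V = allVects p (suc k)
      q Q : ℕ
      q = p ^ k
      Q = p ^ suc k
      instance
        q≢0 : NonZero q
        q≢0 = m^n≢0 p k
      rescale : ∀ p q N → q * (q * (p * (p * N))) ≡ p * q * (p * q * N)
      rescale = solve-∀
      add-square : ∀ Q N → Q * (Q * N) + Q * Q ≡ Q * (Q * suc N)
      add-square = solve-∀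
      ∑∑-const : ∑[ a ∈ V ] ∑[ b ∈ V ] suc N ≡ Q * (Q * suc N)
      ∑∑-const = trans (∑-cong V (λ _ → ∑-allVects-const {p} (suc k) (suc N)))
                       (∑-allVects-const {p} (suc k) (Q * suc N))
      doubleCount : card S < p * (p * N) → Q * (Q * N) + Q * Q ≤ q * (q * card S) + Q * Q
      doubleCount s<p²N = begin
        Q * (Q * N) + Q * Q                            ≡⟨ add-square Q N ⟩
        Q * (Q * suc N)                                ≡⟨ ∑∑-const ⟨
        ∑[ a ∈ V ] ∑[ b ∈ V ] suc N                    ≤⟨ ∑-mono-≤ V (λ a → ∑-mono-≤ V (ℓ>N a)) ⟩
        ∑[ a ∈ V ] ∑[ b ∈ V ] cardInHyperplanes S a b  ≤⟨ ∑∑cardInHyperplanes≤ S ⟩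
        q * (q * card S) + Q * Q                       ∎
        where
        ℓ>N : ∀ a b → N < cardInHyperplanes S a b
        ℓ>N = cardInHyperplanes> S (hyperplaneBound-everywhere S hyp) s<p²N

    cardBound-d≥3 : ∀ {e} (S : Vect p (3 + e) → Bool) n →
                    (∀ a → ¬ IsZeroVect a → n * p ^ (1 + e) ≤ cardInHyperplane S a) →
                    n * p ^ (2 + e) ≤ card S
    cardBound-d≥3 {e} S n hyp = subst (_≤ card S) (sym p²-outside) (cardBound S (n * p ^ e) λ a a≢0 →
      subst (_≤ cardInHyperplane S a) (x*[y*z]≡y*[x*z] n p (p ^ e)) (hyp a a≢0))
      where
      p²-outside : n * p ^ (2 + e) ≡ p * (p * (n * p ^ e))
      p²-outside = trans (x*[y*z]≡y*[x*z] n p (p ^ (1 + e))) (cong (p *_) (x*[y*z]≡y*[x*z] n p (p ^ e)))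

open import Data.Nat as ℕ using (ℕ; suc; _^_; _∸_; _≥_; z≤n; s≤s)
open import Data.Nat.Primality using (Prime)
open import Data.Integer using (ℤ; +_; -[1+_]; _*_; _≤_; +≤+; -≤+)
open import Data.Integer.Properties using (pos-*; drop‿+≤+; *-monoʳ-≤-nonNeg; ≤-trans)
open import Data.Bool using (Bool)
open import Relation.Binary.PropositionalEquality using (subst; sym)
open import Relation.Nullary using (¬_)
open HyperplaneCounting using (cardBound-d≥3)

lemma7p1 : (p : ℕ) → Prime p → (m : ℤ) → (d : ℕ) → d ≥ 3 →
           (S : Vect p d → Bool) →
           ((a : Vect p d) → ¬ IsZeroVect a → m * + (p ^ (d ∸ 2)) ≤ + cardInHyperplane S a) →
           m * + (p ^ (d ∸ 1)) ≤ + card S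
lemma7p1 p p-prime (+ n) (suc (suc (suc e))) (s≤s (s≤s (s≤s z≤n))) S hyp =
  subst (_≤ + card S) (pos-* n (p ^ suc (suc e))) (+≤+ (cardBound-d≥3 p-prime S n hypℕ))
  where
  hypℕ : ∀ a → ¬ IsZeroVect a → n ℕ.* p ^ suc e ℕ.≤ cardInHyperplane S a
  hypℕ a a≢0 = drop‿+≤+ (subst (_≤ + cardInHyperplane S a) (sym (pos-* n (p ^ suc e))) (hyp a a≢0))
lemma7p1 p _ -[1+ k ] (suc (suc (suc e))) (s≤s (s≤s (s≤s z≤n))) _ _ =
  ≤-trans (*-monoʳ-≤-nonNeg (+ (p ^ suc (suc e))) (-≤+ {k} {0})) (+≤+ z≤n)
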